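{- Let $\Gamma=(V,H)$ be an oriented hypergraph with no vertex of degree zero. Then every hypergraph automorphism of $\Gamma$ is a Laplacian automorphism of $\Gamma$, and every Laplacian automorphism of $\Gamma$ is an adjacency automorphism of $\Gamma$. If $\Gamma$ is a simple graph (i.e. it arises from a simple graph $G=(V,E)$ with a choice of edge orientations, so that $|h_{in}|=|h_{out}|=1$ for every $h\in H$), then the adjacency automorphisms of $\Gamma$, the Laplacian automorphisms of $\Gamma$ and the graph automorphisms of $G$ all coincide. In general (for oriented hypergraphs) the converse inclusions do not hold: there exist oriented hypergraphs with an adjacency automorphism that is not a Laplacian automorphism.
   Context: An oriented hypergraph is a pair $\Gamma=(V,H)$ where $V=\{1,\dots,n\}$ is a finite set of vertices and $H$ is a set of hyperedges, each hyperedge being a pair $h=(h_{in},h_{out})$ of disjoint subsets of $V$ (inputs and outputs); the vertices of $h$ are the elements of $h_{in}\cup h_{out}$. The degree $\deg(i)$ of a vertex $i$ is the number of hyperedges containing $i$. Two vertices $i,j$ of a hyperedge $h$ are co-oriented in $h$ if both lie in $h_{in}$ or both lie in $h_{out}$, and anti-oriented in $h$ otherwise. $\deg^+(i,j)$ denotes the number of hyperedges in which $i$ and $j$ are co-oriented and $\deg^-(i,j)$ the number in which they are anti-oriented. The adjacency matrix $A=(A_{ij})$ is the $n\times n$ matrix with $A_{ii}=0$ and $A_{ij}=\deg^-(i,j)-\deg^+(i,j)$ for $i\neq j$. A hypergraph automorphism is a permutation $p$ of $V$ such that $(p(h_{in}),p(h_{out}))\in H$ for every $(h_{in},h_{out})\in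 H$. An adjacency automorphism is a permutation $p$ of $V$ with $A_{p(i)p(j)}=A_{ij}$ for all $i,j$. A Laplacian automorphism is an adjacency automorphism $p$ that also satisfies $\deg(p(i))=\deg(i)$ for all $i$. -}

module Defs where

open import Data.Nat using (ℕ)
open import Data.Integer using (ℤ; _-_) renaming (+_ to ⁺_)
open import Data.Fin using (Fin)
open import Data.Fin.Subset using (Subset; _∈_; _∪_; ⁅_⁆; ∣_∣)
open import Data.Fin.Subset.Properties using (_∈?_)
open import Data.Fin.Permutation using (Permutation′; _⟨$⟩ʳ_; _⟨$⟩ˡ_)
open import Data.Vec using (tabulate; lookup)
open import Data.List using (List; filter; length; map)
open import Data.List.Membership.Propositional using () renaming (_∈_ to _∈ₗ_)
open import Data.List.Relation.Unary.All using (All)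
open import Data.List.Relation.Unary.Any using (Any)
open import Data.List.Relation.Unary.Unique.Propositional using (Unique)
open import Data.Product using (_×_; _,_; proj₁; proj₂)
open import Data.Sum using (_⊎_)
open import Data.Empty using (⊥)
open import Relation.Nullary using (¬_)
open import Relation.Nullary.Decidable using (_×-dec_; _⊎-dec_)
import Data.Fin
import Relation.Nullary
open import Relation.Binary.PropositionalEquality using (_≡_; _≢_)
open import Function.Bundles using (_⇔_)

Hyperedge : ℕ → Set
Hyperedge n = Subset n × Subset n

inputs outputs vertices : ∀ {n} → Hyperedge n → Subset n
inputs  h = proj₁ h
outputs h = proj₂ h
vertices h = proj₁ h ∪ proj₂ h

Disjoint : ∀ {n} → Subset n → Subset n → Set
Disjoint {n} a b = (i : Fin n) → i ∈ a → i ∈ b → ⊥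

record OrientedHypergraph (n : ℕ) : Set where
  field
    edges    : List (Hyperedge n)
    unique   : Unique edges
    disjoint : All (λ h → Disjoint (inputs h) (outputs h)) edges
open OrientedHypergraph public

module _ {n : ℕ} (Γ : OrientedHypergraph n) where

  deg : Fin n → ℕ
  deg i = length (filter (λ h → i ∈? vertices h) (edges Γ))

  CoOriented AntiOriented : Fin n → Fin n → Hyperedge n → Set
  CoOriented i j h =
    (i ∈ inputs h × j ∈ inputs h) ⊎ (i ∈ outputs h × j ∈ outputs h)
  AntiOriented i j h =
    (i ∈ inputs h × j ∈ outputs h) ⊎ (i ∈ outputs h × j ∈ inputs h)

  deg⁺ deg⁻ : Fin n → Fin n → ℕ
  deg⁺ i j = length (filter (λ h → ((i ∈? inputs h) ×-dec (j ∈? inputs h))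
                                ⊎-dec ((i ∈? outputs h) ×-dec (j ∈? outputs h)))
                            (edges Γ))
  deg⁻ i j = length (filter (λ h → ((i ∈? inputs h) ×-dec (j ∈? outputs h))
                                ⊎-dec ((i ∈? outputs h) ×-dec (j ∈? inputs h)))
                            (edges Γ))

  adj : Fin n → Fin n → ℤ
  adj i j with i Data.Fin.≟ j
  ... | Relation.Nullary.yes _ = ⁺ 0
  ... | Relation.Nullary.no  _ = ⁺ deg⁻ i j - ⁺ deg⁺ i j

  NoIsolatedVertex : Set
  NoIsolatedVertex = (i : Fin n) → deg i ≢ 0

  -- image of a subset under a permutation: p(s) = { p i | i ∈ s }
  image : Permutation′ n → Subset n → Subset n
  image p s = tabulate (λ j → lookup s (p ⟨$⟩ˡ j))

  IsHypergraphAutomorphism : Permutation′ n → Set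
  IsHypergraphAutomorphism p =
    (h : Hyperedge n) → h ∈ₗ edges Γ →
    (image p (inputs h) , image p (outputs h)) ∈ₗ edges Γ

  IsAdjacencyAutomorphism : Permutation′ n → Set
  IsAdjacencyAutomorphism p =
    (i j : Fin n) → adj (p ⟨$⟩ʳ i) (p ⟨$⟩ʳ j) ≡ adj i j

  IsLaplacianAutomorphism : Permutation′ n → Set
  IsLaplacianAutomorphism p =
    IsAdjacencyAutomorphism p × ((i : Fin n) → deg (p ⟨$⟩ʳ i) ≡ deg i)

  -- Γ arises from a simple graph G with a choice of edge orientations:
  -- every hyperedge has exactly one input and one output, and distinct
  -- hyperedges have distinct vertex sets (no multiple edges).
  IsSimpleGraph : Set
  IsSimpleGraph =
    All (λ h → ∣ inputs h ∣ ≡ 1 × ∣ outputs h ∣ ≡ 1) (edges Γ)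
    × Unique (map vertices (edges Γ))

  GEdge : Fin n → Fin n → Set
  GEdge i j = Any (λ h → vertices h ≡ ⁅ i ⁆ ∪ ⁅ j ⁆) (edges Γ) × i ≢ j

  IsGraphAutomorphism : Permutation′ n → Set
  IsGraphAutomorphism p =
    (i j : Fin n) → GEdge i j ⇔ GEdge (p ⟨$⟩ʳ i) (p ⟨$⟩ʳ j)

-- A hypergraph automorphism maps the duplicate-free list of hyperedges
-- injectively into itself, hence permutes it; so the number of hyperedges with a
-- property does not change when the property is transported along it, which
-- gives the invariance of deg, deg⁺ and deg⁻, hence of the adjacency matrix.
-- In a simple graph deg⁺ vanishes off the diagonal and deg⁻ i j ∈ {0, 1} records
-- whether {i, j} is an edge, while deg i counts the neighbours of i; so adjacency
-- automorphisms and graph automorphisms are both exactly the permutations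
-- preserving adjacency, and these preserve degrees.
-- Swapping the vertices of the hypergraph with hyperedges ({0},∅) and ({0},{1})
-- preserves A = [[0,1],[1,0]] but not the degrees 2 and 1.
module Submission where

open import Defs
open import Level using (Level)
open import Data.Nat using (ℕ; suc; _+_; _≤_; _<_; z≤n; s≤s)
open import Data.Nat.Properties
  using (≤-antisym; ≤-trans; ≤-reflexive; +-suc; +-monoʳ-≤; +-cancelʳ-≤; suc-injective; <⇒≢)
open import Data.Integer using (_-_) renaming (+_ to ⁺_)
import Data.Integer.Properties as ℤ
open import Data.Fin using (Fin; _≟_)
open import Data.Fin.Patterns using (0F; 1F)
open import Data.Fin.Subset using (Subset; _∈_; _⊆_; _∪_; ⁅_⁆; ∣_∣; ⊥; inside; outside)
open import Data.Fin.Subset.Properties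
  using (_∈?_; ∪⇔⊎; ∪-comm; x∈⁅x⁆; x∈⁅y⁆⇒x≡y; ⊆-antisym)
open import Data.Fin.Permutation using (Permutation; Permutation′; _⟨$⟩ʳ_; inverseˡ; transpose)
open import Data.Vec using (_∷_; []; lookup; there)
open import Data.Vec.Properties using (lookup∘tabulate; []=⇒lookup; lookup⇒[]=)
open import Data.List using (List; []; _∷_; _++_; length; filter; map; allFin)
open import Data.List.Properties using (length-++-sucʳ; filter-some; filter-none)
open import Data.List.Membership.Propositional using (find; lose) renaming (_∈_ to _∈ₗ_)
open import Data.List.Membership.Propositional.Properties
  using (∈-∃++; ∈-filter⁺; ∈-filter⁻; ∈-map⁺; ∈-allFin)
open import Data.List.Relation.Unary.Any using (Any; here; there; any?)
open import Data.List.Relation.Unary.All as All using (All; []; _∷_)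
open import Data.List.Relation.Unary.All.Properties using (¬Any⇒All¬)
open import Data.List.Relation.Unary.AllPairs using ([]; _∷_)
open import Data.List.Relation.Unary.Unique.Propositional using (Unique)
import Data.List.Relation.Unary.Unique.Propositional.Properties as Unique
open import Data.Product using (_×_; _,_; proj₁; proj₂; ∃; Σ)
open import Data.Product.Function.NonDependent.Propositional using (_×-⇔_)
open import Data.Sum using (_⊎_; inj₁; inj₂)
open import Data.Sum.Function.Propositional using (_⊎-⇔_)
open import Data.Empty using (⊥-elim)
open import Function using (_∘_)
open import Function.Bundles using (_⇔_; mk⇔; Equivalence; Injection)
open import Function.Construct.Composition using (_⇔-∘_)
open import Function.Construct.Symmetry using (⇔-sym)
open import Function.Definitions using (Injective)
open import Function.Properties.Inverse using (↔⇒↣)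
open import Relation.Nullary using (¬_; Dec; yes; no; contradiction)
open import Relation.Nullary.Decidable using (_×-dec_; _⊎-dec_; decidable-stable)
open import Relation.Unary using (Pred; Decidable)
open import Relation.Unary.Properties using (∁?)
open import Relation.Binary.PropositionalEquality
  using (_≡_; _≢_; refl; sym; trans; cong; cong₂; subst; module ≡-Reasoning)

open Equivalence using (to; from)

private
  variable
    a b p q r : Level
    A B : Set a

⟨$⟩ʳ-injective : ∀ {m n} (π : Permutation m n) → Injective _≡_ _≡_ (π ⟨$⟩ʳ_)
⟨$⟩ʳ-injective π = Injection.injective (↔⇒↣ π)

∈-++-∷⁻ : ∀ {z w : A} ys zs → z ∈ₗ ys ++ w ∷ zs → z ≢ w → z ∈ₗ ys ++ zs
∈-++-∷⁻ []       zs (here z≡w)  z≢w = contradiction z≡w z≢w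
∈-++-∷⁻ []       zs (there z∈)  _   = z∈
∈-++-∷⁻ (y ∷ ys) zs (here z≡y)  _   = here z≡y
∈-++-∷⁻ (y ∷ ys) zs (there z∈)  z≢w = there (∈-++-∷⁻ ys zs z∈ z≢w)

length-≤-by-injectiveRelation :
  ∀ (R : A → B → Set r) {xs : List A} {ys : List B} → Unique xs →
  (∀ {x} → x ∈ₗ xs → ∃ λ y → y ∈ₗ ys × R x y) →
  (∀ {x x′ y} → x ∈ₗ xs → x′ ∈ₗ xs → R x y → R x′ y → x ≡ x′) →
  length xs ≤ length ys
length-≤-by-injectiveRelation R {[]}     _               _     _         = z≤n
length-≤-by-injectiveRelation R {x ∷ xs} {ys} (x∉xs ∷ uniq) total injective
  with y , y∈ys , Rxy ← total (here refl)
  with ys₁ , ys₂ , refl ← ∈-∃++ y∈ys =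
  ≤-trans (s≤s (length-≤-by-injectiveRelation R uniq total′ (λ x∈ x′∈ → injective (there x∈) (there x′∈))))
          (≤-reflexive (sym (length-++-sucʳ ys₁ y ys₂)))
  where
  total′ : ∀ {x′} → x′ ∈ₗ xs → ∃ λ y′ → y′ ∈ₗ ys₁ ++ ys₂ × R x′ y′
  total′ x′∈xs with y′ , y′∈ys , Rx′y′ ← total (there x′∈xs) =
    y′ , ∈-++-∷⁻ ys₁ ys₂ y′∈ys y′≢y , Rx′y′
    where
    y′≢y : y′ ≢ y
    y′≢y refl = All.lookup x∉xs x′∈xs (injective (here refl) (there x′∈xs) Rxy Rx′y′)

all-equal⇒length≤1 : ∀ {xs : List A} → Unique xs →
  (∀ {x y} → x ∈ₗ xs → y ∈ₗ xs → x ≡ y) → length xs ≤ 1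
all-equal⇒length≤1 {xs = []}    _    _     = z≤n
all-equal⇒length≤1 {xs = x ∷ _} uniq equal =
  length-≤-by-injectiveRelation _≡_ {ys = x ∷ []} uniq
    (λ y∈ → x , here refl , equal y∈ (here refl)) (λ _ _ e e′ → trans e (sym e′))

Unique-map⇒injectiveOn : ∀ (f : A → B) {xs} → Unique (map f xs) →
  ∀ {x y} → x ∈ₗ xs → y ∈ₗ xs → f x ≡ f y → x ≡ y
Unique-map⇒injectiveOn f (_ ∷ _)      (here refl) (here refl) _   = refl
Unique-map⇒injectiveOn f (fx∉ ∷ _)    (here refl) (there y∈)  fx≡ =
  contradiction fx≡ (All.lookup fx∉ (∈-map⁺ f y∈))
Unique-map⇒injectiveOn f (fy∉ ∷ _)    (there x∈)  (here refl) fx≡ =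
  contradiction (sym fx≡) (All.lookup fy∉ (∈-map⁺ f x∈))
Unique-map⇒injectiveOn f (_ ∷ uniq)   (there x∈)  (there y∈)  fx≡ = Unique-map⇒injectiveOn f uniq x∈ y∈ fx≡

module _ {P : Pred A p} (P? : Decidable P) where

  length-filter+length-filter-∁ : ∀ xs →
    length (filter P? xs) + length (filter (∁? P?) xs) ≡ length xs
  length-filter+length-filter-∁ []       = refl
  length-filter+length-filter-∁ (x ∷ xs) with P? x
  ... | yes _ = cong suc (length-filter+length-filter-∁ xs)
  ... | no  _ = trans (+-suc _ _) (cong suc (length-filter+length-filter-∁ xs))

  0<length-filter⇔Any : ∀ {xs} → 0 < length (filter P? xs) ⇔ Any P xs
  0<length-filter⇔Any {xs} = mk⇔ some⇒Any (filter-some P?)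
    where
    some⇒Any : 0 < length (filter P? xs) → Any P xs
    some⇒Any 0<len = decidable-stable (any? P? xs) λ ¬any →
      <⇒≢ 0<len (sym (cong length (filter-none P? (¬Any⇒All¬ xs ¬any))))

-- f maps the P-elements into the Q-elements and the others into the others;
-- as both pairs of counts add up to length xs, both inequalities are equalities.
length-filter-invariant :
  ∀ {P : Pred A p} {Q : Pred A q} (P? : Decidable P) (Q? : Decidable Q)
    {f : A → A} {xs} → Unique xs → Injective _≡_ _≡_ f → (∀ {x} → x ∈ₗ xs → f x ∈ₗ xs) →
  (∀ x → P x ⇔ Q (f x)) → length (filter P? xs) ≡ length (filter Q? xs)
length-filter-invariant {A = A} P? Q? {f} {xs} uniq f-injective f-closed P⇔Q∘f =
  ≤+≤-≡⇒≡ (embed P? Q? (to (P⇔Q∘f _))) (embed (∁? P?) (∁? Q?) (λ ¬Px → ¬Px ∘ from (P⇔Q∘f _)))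
    (trans (length-filter+length-filter-∁ P? xs) (sym (length-filter+length-filter-∁ Q? xs)))
  where
  embed : ∀ {r s} {R : Pred A r} {S : Pred A s} (R? : Decidable R) (S? : Decidable S) →
    (∀ {x} → R x → S (f x)) → length (filter R? xs) ≤ length (filter S? xs)
  embed R? S? R⇒S∘f = length-≤-by-injectiveRelation (λ x y → f x ≡ y) (Unique.filter⁺ R? uniq)
    (λ x∈ → let x∈xs , Rx = ∈-filter⁻ R? x∈ in f _ , ∈-filter⁺ S? (f-closed x∈xs) (R⇒S∘f Rx) , refl)
    (λ _ _ fx≡y fx′≡y → f-injective (trans fx≡y (sym fx′≡y)))
  ≤+≤-≡⇒≡ : ∀ {m n m′ n′} → m ≤ m′ → n ≤ n′ → m + n ≡ m′ + n′ → m ≡ m′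
  ≤+≤-≡⇒≡ {m} {n} {m′} {n′} m≤m′ n≤n′ eq = ≤-antisym m≤m′
    (+-cancelʳ-≤ n′ m′ m (≤-trans (≤-reflexive (sym eq)) (+-monoʳ-≤ m n≤n′)))

∣p∣≡0⇒p≡⊥ : ∀ {n} {s : Subset n} → ∣ s ∣ ≡ 0 → s ≡ ⊥
∣p∣≡0⇒p≡⊥ {s = []}          _  = refl
∣p∣≡0⇒p≡⊥ {s = outside ∷ s} eq = cong (outside ∷_) (∣p∣≡0⇒p≡⊥ eq)

∣p∣≡1⇒singleton : ∀ {n} {s : Subset n} → ∣ s ∣ ≡ 1 → ∃ λ x → s ≡ ⁅ x ⁆
∣p∣≡1⇒singleton {s = inside ∷ s}  eq = 0F , cong (inside ∷_) (∣p∣≡0⇒p≡⊥ (suc-injective eq))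
∣p∣≡1⇒singleton {s = outside ∷ s} eq =
  let x , s≡⁅x⁆ = ∣p∣≡1⇒singleton eq in Data.Fin.suc x , cong (outside ∷_) s≡⁅x⁆

∣p∣≡1⇒p≡⁅x⁆ : ∀ {n} {s : Subset n} {x} → ∣ s ∣ ≡ 1 → x ∈ s → s ≡ ⁅ x ⁆
∣p∣≡1⇒p≡⁅x⁆ {s = s} eq x∈s with y , refl ← ∣p∣≡1⇒singleton {s = s} eq =
  cong ⁅_⁆ (sym (x∈⁅y⁆⇒x≡y y x∈s))

∣p∣≡1⇒∈-unique : ∀ {n} {s : Subset n} {x y} → ∣ s ∣ ≡ 1 → x ∈ s → y ∈ s → x ≡ y
∣p∣≡1⇒∈-unique eq x∈s y∈s = sym (x∈⁅y⁆⇒x≡y _ (subst (_ ∈_) (∣p∣≡1⇒p≡⁅x⁆ eq x∈s) y∈s))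

∣p∣≡1⇒nonempty : ∀ {n} {s : Subset n} → ∣ s ∣ ≡ 1 → ∃ (_∈ s)
∣p∣≡1⇒nonempty {s = s} eq with x , refl ← ∣p∣≡1⇒singleton {s = s} eq = x , x∈⁅x⁆ x

module _ {n : ℕ} (Γ : OrientedHypergraph n) where

  -- Literally the test in the definition of deg⁻, so that deg⁻ Γ i j is
  -- definitionally length (filter (antiOriented? i j) (edges Γ)).
  antiOriented? : ∀ i j → Decidable (AntiOriented Γ i j)
  antiOriented? i j h =
    ((i ∈? inputs h) ×-dec (j ∈? outputs h)) ⊎-dec ((i ∈? outputs h) ×-dec (j ∈? inputs h))

  Adjacent : Fin n → Fin n → Set
  Adjacent i j = Any (AntiOriented Γ i j) (edges Γ)

  Adjacent? : ∀ i → Decidable (Adjacent i)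
  Adjacent? i j = any? (antiOriented? i j) (edges Γ)

  PreservesAdjacency : Permutation′ n → Set
  PreservesAdjacency π = ∀ i j → Adjacent (π ⟨$⟩ʳ i) (π ⟨$⟩ʳ j) ⇔ Adjacent i j

  0<deg⁻⇔Adjacent : ∀ {i j} → 0 < deg⁻ Γ i j ⇔ Adjacent i j
  0<deg⁻⇔Adjacent {i} {j} = 0<length-filter⇔Any (antiOriented? i j)

  disjoint-at : ∀ {h} → h ∈ₗ edges Γ → Disjoint (inputs h) (outputs h)
  disjoint-at = All.lookup (disjoint Γ)

  antiOriented-irreflexive : ∀ {h i j} → h ∈ₗ edges Γ → AntiOriented Γ i j h → i ≢ j
  antiOriented-irreflexive h∈ (inj₁ (i∈in , j∈out)) refl = disjoint-at h∈ _ i∈in j∈out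
  antiOriented-irreflexive h∈ (inj₂ (i∈out , j∈in)) refl = disjoint-at h∈ _ j∈in i∈out

  antiOriented⇒∈vertices : ∀ {h i j} → AntiOriented Γ i j h → i ∈ vertices h
  antiOriented⇒∈vertices (inj₁ (i∈in , _))  = from ∪⇔⊎ (inj₁ i∈in)
  antiOriented⇒∈vertices (inj₂ (i∈out , _)) = from ∪⇔⊎ (inj₂ i∈out)

  deg⁻-diagonal : ∀ i → deg⁻ Γ i i ≡ 0
  deg⁻-diagonal i = cong length (filter-none (antiOriented? i i)
    (All.tabulate (λ h∈ anti → antiOriented-irreflexive h∈ anti refl)))

  adj-diagonal : ∀ i → adj Γ i i ≡ ⁺ 0
  adj-diagonal i with i ≟ i
  ... | yes _   = refl
  ... | no  i≢i = contradiction refl i≢i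

  adj-offDiagonal : ∀ {i j} → i ≢ j → adj Γ i j ≡ ⁺ deg⁻ Γ i j - ⁺ deg⁺ Γ i j
  adj-offDiagonal {i} {j} i≢j with i ≟ j
  ... | yes i≡j = contradiction i≡j i≢j
  ... | no  _   = refl

  module _ (π : Permutation′ n) where

    deg±-preserved⇒adjacencyAutomorphism :
      (∀ i j → deg⁻ Γ (π ⟨$⟩ʳ i) (π ⟨$⟩ʳ j) ≡ deg⁻ Γ i j) →
      (∀ i j → deg⁺ Γ (π ⟨$⟩ʳ i) (π ⟨$⟩ʳ j) ≡ deg⁺ Γ i j) →
      IsAdjacencyAutomorphism Γ π
    deg±-preserved⇒adjacencyAutomorphism deg⁻-pres deg⁺-pres i j = by-cases (i ≟ j)
      where
      open ≡-Reasoning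
      by-cases : ∀ {i j} → Dec (i ≡ j) → adj Γ (π ⟨$⟩ʳ i) (π ⟨$⟩ʳ j) ≡ adj Γ i j
      by-cases {i} (yes refl) = trans (adj-diagonal (π ⟨$⟩ʳ i)) (sym (adj-diagonal i))
      by-cases {i} {j} (no i≢j) = begin
        adj Γ (π ⟨$⟩ʳ i) (π ⟨$⟩ʳ j)
          ≡⟨ adj-offDiagonal (i≢j ∘ ⟨$⟩ʳ-injective π) ⟩
        ⁺ deg⁻ Γ (π ⟨$⟩ʳ i) (π ⟨$⟩ʳ j) - ⁺ deg⁺ Γ (π ⟨$⟩ʳ i) (π ⟨$⟩ʳ j)
          ≡⟨ cong₂ (λ m k → ⁺ m - ⁺ k) (deg⁻-pres i j) (deg⁺-pres i j) ⟩
        ⁺ deg⁻ Γ i j - ⁺ deg⁺ Γ i j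
          ≡⟨ adj-offDiagonal i≢j ⟨
        adj Γ i j
          ∎

    ∈-image : ∀ {s i} → i ∈ s ⇔ π ⟨$⟩ʳ i ∈ image Γ π s
    ∈-image {s} {i} = mk⇔
      (λ i∈s → lookup⇒[]= _ _ (trans lookup-image ([]=⇒lookup i∈s)))
      (λ πi∈ → lookup⇒[]= _ _ (trans (sym lookup-image) ([]=⇒lookup πi∈)))
      where
      lookup-image : lookup (image Γ π s) (π ⟨$⟩ʳ i) ≡ lookup s i
      lookup-image = trans (lookup∘tabulate _ (π ⟨$⟩ʳ i)) (cong (lookup s) (inverseˡ π))

    image-injective : Injective _≡_ _≡_ (image Γ π)
    image-injective eq = ⊆-antisym (transport eq) (transport (sym eq))
      where
      transport : ∀ {s t} → image Γ π s ≡ image Γ π t → s ⊆ t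
      transport eq i∈s = from ∈-image (subst (_ ∈_) eq (to ∈-image i∈s))

    imageEdge : Hyperedge n → Hyperedge n
    imageEdge h = image Γ π (inputs h) , image Γ π (outputs h)

    imageEdge-injective : Injective _≡_ _≡_ imageEdge
    imageEdge-injective eq = cong₂ _,_ (image-injective (cong proj₁ eq)) (image-injective (cong proj₂ eq))

    module _ (automorphism : IsHypergraphAutomorphism Γ π) where

      length-filter-edges-invariant :
        ∀ {P : Pred (Hyperedge n) p} {Q : Pred (Hyperedge n) q} (P? : Decidable P) (Q? : Decidable Q) →
        (∀ h → P h ⇔ Q (imageEdge h)) →
        length (filter P? (edges Γ)) ≡ length (filter Q? (edges Γ))
      length-filter-edges-invariant P? Q? =
        length-filter-invariant P? Q? (unique Γ) imageEdge-injective (automorphism _)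

      deg-preserved : ∀ i → deg Γ (π ⟨$⟩ʳ i) ≡ deg Γ i
      deg-preserved i = sym (length-filter-edges-invariant _ _ (λ _ →
        ⇔-sym ∪⇔⊎ ⇔-∘ ((∈-image ⊎-⇔ ∈-image) ⇔-∘ ∪⇔⊎)))

      deg⁻-preserved : ∀ i j → deg⁻ Γ (π ⟨$⟩ʳ i) (π ⟨$⟩ʳ j) ≡ deg⁻ Γ i j
      deg⁻-preserved i j = sym (length-filter-edges-invariant _ _ (λ _ →
        (∈-image ×-⇔ ∈-image) ⊎-⇔ (∈-image ×-⇔ ∈-image)))

      deg⁺-preserved : ∀ i j → deg⁺ Γ (π ⟨$⟩ʳ i) (π ⟨$⟩ʳ j) ≡ deg⁺ Γ i j
      deg⁺-preserved i j = sym (length-filter-edges-invariant _ _ (λ _ →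
        (∈-image ×-⇔ ∈-image) ⊎-⇔ (∈-image ×-⇔ ∈-image)))

      hypergraphAutomorphism⇒laplacianAutomorphism : IsLaplacianAutomorphism Γ π
      hypergraphAutomorphism⇒laplacianAutomorphism =
        deg±-preserved⇒adjacencyAutomorphism deg⁻-preserved deg⁺-preserved , deg-preserved

  module _ (simple : IsSimpleGraph Γ) where

    private
      ∣inputs∣≡1 : ∀ {h} → h ∈ₗ edges Γ → ∣ inputs h ∣ ≡ 1
      ∣inputs∣≡1 h∈ = proj₁ (All.lookup (proj₁ simple) h∈)

      ∣outputs∣≡1 : ∀ {h} → h ∈ₗ edges Γ → ∣ outputs h ∣ ≡ 1
      ∣outputs∣≡1 h∈ = proj₂ (All.lookup (proj₁ simple) h∈)

    coOriented⇒≡ : ∀ {h i j} → h ∈ₗ edges Γ → CoOriented Γ i j h → i ≡ j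
    coOriented⇒≡ h∈ (inj₁ (i∈in  , j∈in))  = ∣p∣≡1⇒∈-unique (∣inputs∣≡1 h∈) i∈in j∈in
    coOriented⇒≡ h∈ (inj₂ (i∈out , j∈out)) = ∣p∣≡1⇒∈-unique (∣outputs∣≡1 h∈) i∈out j∈out

    antiOriented⇒vertices≡ : ∀ {h i j} → h ∈ₗ edges Γ → AntiOriented Γ i j h →
      vertices h ≡ ⁅ i ⁆ ∪ ⁅ j ⁆
    antiOriented⇒vertices≡ h∈ (inj₁ (i∈in , j∈out)) =
      cong₂ _∪_ (∣p∣≡1⇒p≡⁅x⁆ (∣inputs∣≡1 h∈) i∈in) (∣p∣≡1⇒p≡⁅x⁆ (∣outputs∣≡1 h∈) j∈out)
    antiOriented⇒vertices≡ {i = i} {j} h∈ (inj₂ (i∈out , j∈in)) =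
      trans (cong₂ _∪_ (∣p∣≡1⇒p≡⁅x⁆ (∣inputs∣≡1 h∈) j∈in) (∣p∣≡1⇒p≡⁅x⁆ (∣outputs∣≡1 h∈) i∈out))
            (∪-comm ⁅ j ⁆ ⁅ i ⁆)

    vertices≡⇒antiOriented : ∀ {h i j} → h ∈ₗ edges Γ → vertices h ≡ ⁅ i ⁆ ∪ ⁅ j ⁆ → i ≢ j →
      AntiOriented Γ i j h
    vertices≡⇒antiOriented {i = i} {j} h∈ vertices≡ i≢j
      with to ∪⇔⊎ (subst (i ∈_) (sym vertices≡) (from ∪⇔⊎ (inj₁ (x∈⁅x⁆ i))))
         | to ∪⇔⊎ (subst (j ∈_) (sym vertices≡) (from ∪⇔⊎ (inj₂ (x∈⁅x⁆ j))))
    ... | inj₁ i∈in  | inj₂ j∈out = inj₁ (i∈in , j∈out)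
    ... | inj₂ i∈out | inj₁ j∈in  = inj₂ (i∈out , j∈in)
    ... | inj₁ i∈in  | inj₁ j∈in  = contradiction (coOriented⇒≡ h∈ (inj₁ (i∈in , j∈in))) i≢j
    ... | inj₂ i∈out | inj₂ j∈out = contradiction (coOriented⇒≡ h∈ (inj₂ (i∈out , j∈out))) i≢j

    antiOriented-functional : ∀ {h i j j′} → h ∈ₗ edges Γ →
      AntiOriented Γ i j h → AntiOriented Γ i j′ h → j ≡ j′
    antiOriented-functional h∈ (inj₁ (_ , j∈out)) (inj₁ (_ , j′∈out)) =
      ∣p∣≡1⇒∈-unique (∣outputs∣≡1 h∈) j∈out j′∈out
    antiOriented-functional h∈ (inj₂ (_ , j∈in))  (inj₂ (_ , j′∈in))  =
      ∣p∣≡1⇒∈-unique (∣inputs∣≡1 h∈) j∈in j′∈in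
    antiOriented-functional h∈ (inj₁ (i∈in , _))  (inj₂ (i∈out , _))  = ⊥-elim (disjoint-at h∈ _ i∈in i∈out)
    antiOriented-functional h∈ (inj₂ (i∈out , _)) (inj₁ (i∈in , _))   = ⊥-elim (disjoint-at h∈ _ i∈in i∈out)

    antiOriented-injective : ∀ {h h′ i j} → h ∈ₗ edges Γ → h′ ∈ₗ edges Γ →
      AntiOriented Γ i j h → AntiOriented Γ i j h′ → h ≡ h′
    antiOriented-injective h∈ h′∈ anti anti′ = Unique-map⇒injectiveOn vertices (proj₂ simple) h∈ h′∈
      (trans (antiOriented⇒vertices≡ h∈ anti) (sym (antiOriented⇒vertices≡ h′∈ anti′)))

    opposite-endpoint : ∀ {h i} → h ∈ₗ edges Γ → i ∈ vertices h → ∃ λ j → AntiOriented Γ i j h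
    opposite-endpoint h∈ i∈ with to ∪⇔⊎ i∈
    ... | inj₁ i∈in  = let j , j∈out = ∣p∣≡1⇒nonempty (∣outputs∣≡1 h∈) in j , inj₁ (i∈in , j∈out)
    ... | inj₂ i∈out = let j , j∈in  = ∣p∣≡1⇒nonempty (∣inputs∣≡1 h∈)  in j , inj₂ (i∈out , j∈in)

    deg⁺-offDiagonal : ∀ {i j} → i ≢ j → deg⁺ Γ i j ≡ 0
    deg⁺-offDiagonal i≢j = cong length (filter-none _ (All.tabulate (λ h∈ co → i≢j (coOriented⇒≡ h∈ co))))

    adj≡deg⁻ : ∀ i j → adj Γ i j ≡ ⁺ deg⁻ Γ i j
    adj≡deg⁻ i j with i ≟ j
    ... | yes refl = cong ⁺_ (sym (deg⁻-diagonal i))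
    ... | no  i≢j  = begin
      ⁺ deg⁻ Γ i j - ⁺ deg⁺ Γ i j ≡⟨ cong (λ m → ⁺ deg⁻ Γ i j - ⁺ m) (deg⁺-offDiagonal i≢j) ⟩
      ⁺ deg⁻ Γ i j - ⁺ 0          ≡⟨ ℤ.+-identityʳ (⁺ deg⁻ Γ i j) ⟩
      ⁺ deg⁻ Γ i j                ∎
      where open ≡-Reasoning

    deg⁻≤1 : ∀ i j → deg⁻ Γ i j ≤ 1
    deg⁻≤1 i j = all-equal⇒length≤1 (Unique.filter⁺ (antiOriented? i j) (unique Γ)) λ h∈ h′∈ →
      let h∈edges , anti = ∈-filter⁻ (antiOriented? i j) h∈
          h′∈edges , anti′ = ∈-filter⁻ (antiOriented? i j) h′∈
      in antiOriented-injective h∈edges h′∈edges anti anti′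

    adj≡adj⇔deg⁻≡deg⁻ : ∀ {i j k l} → adj Γ i j ≡ adj Γ k l ⇔ deg⁻ Γ i j ≡ deg⁻ Γ k l
    adj≡adj⇔deg⁻≡deg⁻ {i} {j} {k} {l} = mk⇔
      (λ adj≡ → ℤ.+-injective (trans (sym (adj≡deg⁻ i j)) (trans adj≡ (adj≡deg⁻ k l))))
      (λ deg⁻≡ → trans (adj≡deg⁻ i j) (trans (cong ⁺_ deg⁻≡) (sym (adj≡deg⁻ k l))))

    deg⁻≡deg⁻⇔Adjacent⇔Adjacent : ∀ {i j k l} → deg⁻ Γ i j ≡ deg⁻ Γ k l ⇔ (Adjacent i j ⇔ Adjacent k l)
    deg⁻≡deg⁻⇔Adjacent⇔Adjacent {i} {j} {k} {l} = mk⇔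
      (λ deg⁻≡ → subst (λ m → 0 < m ⇔ Adjacent k l) (sym deg⁻≡) 0<deg⁻⇔Adjacent ⇔-∘ ⇔-sym 0<deg⁻⇔Adjacent)
      (λ adjacent⇔ → ≤1-≡ (deg⁻≤1 i j) (deg⁻≤1 k l) (⇔-sym 0<deg⁻⇔Adjacent ⇔-∘ (adjacent⇔ ⇔-∘ 0<deg⁻⇔Adjacent)))
      where
      ≤1-≡ : ∀ {m n} → m ≤ 1 → n ≤ 1 → 0 < m ⇔ 0 < n → m ≡ n
      ≤1-≡ z≤n       z≤n       _     = refl
      ≤1-≡ (s≤s z≤n) (s≤s z≤n) _     = refl
      ≤1-≡ z≤n       (s≤s z≤n) 0<⇔0< = contradiction (from 0<⇔0< (s≤s z≤n)) λ ()
      ≤1-≡ (s≤s z≤n) z≤n       0<⇔0< = contradiction (to 0<⇔0< (s≤s z≤n)) λ ()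

    GEdge⇔Adjacent : ∀ {i j} → GEdge Γ i j ⇔ Adjacent i j
    GEdge⇔Adjacent = mk⇔
      (λ (edge , i≢j) → let _ , h∈ , vertices≡ = find edge in lose h∈ (vertices≡⇒antiOriented h∈ vertices≡ i≢j))
      (λ adjacent → let _ , h∈ , anti = find adjacent in
         lose h∈ (antiOriented⇒vertices≡ h∈ anti) , antiOriented-irreflexive h∈ anti)

    -- Each hyperedge at i joins i to exactly one neighbour, and distinct
    -- neighbours are joined by distinct hyperedges.
    deg≡#neighbours : ∀ i → deg Γ i ≡ length (filter (Adjacent? i) (allFin n))
    deg≡#neighbours i = ≤-antisym
      (length-≤-by-injectiveRelation (λ h j → Joins j h) (Unique.filter⁺ _ (unique Γ))
        (λ h∈ → let h∈edges , i∈ = ∈-filter⁻ _ h∈ ; j , anti = opposite-endpoint h∈edges i∈ in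
           j , ∈-filter⁺ (Adjacent? i) (∈-allFin j) (lose h∈edges anti) , h∈edges , anti)
        (λ _ _ (h∈ , anti) (h′∈ , anti′) → antiOriented-injective h∈ h′∈ anti anti′))
      (length-≤-by-injectiveRelation Joins (Unique.filter⁺ (Adjacent? i) (Unique.allFin⁺ n))
        (λ j∈ → let h , h∈ , anti = find (proj₂ (∈-filter⁻ (Adjacent? i) {xs = allFin n} j∈)) in
           h , ∈-filter⁺ _ h∈ (antiOriented⇒∈vertices anti) , h∈ , anti)
        (λ _ _ (h∈ , anti) (_ , anti′) → antiOriented-functional h∈ anti anti′))
      where
      Joins : Fin n → Hyperedge n → Set
      Joins j h = h ∈ₗ edges Γ × AntiOriented Γ i j h

    module _ (π : Permutation′ n) where

      adjacencyAutomorphism⇔preservesAdjacency : IsAdjacencyAutomorphism Γ π ⇔ PreservesAdjacency π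
      adjacencyAutomorphism⇔preservesAdjacency = mk⇔
        (λ automorphism i j → to deg⁻≡deg⁻⇔Adjacent⇔Adjacent (to adj≡adj⇔deg⁻≡deg⁻ (automorphism i j)))
        (λ preserves i j → from adj≡adj⇔deg⁻≡deg⁻ (from deg⁻≡deg⁻⇔Adjacent⇔Adjacent (preserves i j)))

      graphAutomorphism⇔preservesAdjacency : IsGraphAutomorphism Γ π ⇔ PreservesAdjacency π
      graphAutomorphism⇔preservesAdjacency = mk⇔
        (λ automorphism i j → GEdge⇔Adjacent ⇔-∘ (⇔-sym (automorphism i j) ⇔-∘ ⇔-sym GEdge⇔Adjacent))
        (λ preserves i j → ⇔-sym GEdge⇔Adjacent ⇔-∘ (⇔-sym (preserves i j) ⇔-∘ GEdge⇔Adjacent))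

      preservesAdjacency⇒deg-preserved : PreservesAdjacency π → ∀ i → deg Γ (π ⟨$⟩ʳ i) ≡ deg Γ i
      preservesAdjacency⇒deg-preserved preserves i = begin
        deg Γ (π ⟨$⟩ʳ i)
          ≡⟨ deg≡#neighbours (π ⟨$⟩ʳ i) ⟩
        length (filter (Adjacent? (π ⟨$⟩ʳ i)) (allFin n))
          ≡⟨ length-filter-invariant (Adjacent? i) (Adjacent? (π ⟨$⟩ʳ i)) (Unique.allFin⁺ n)
               (⟨$⟩ʳ-injective π) (λ _ → ∈-allFin _) (λ j → ⇔-sym (preserves i j)) ⟨
        length (filter (Adjacent? i) (allFin n))
          ≡⟨ deg≡#neighbours i ⟨
        deg Γ i
          ∎
        where open ≡-Reasoning

      adjacencyAutomorphism⇒laplacianAutomorphism : IsAdjacencyAutomorphism Γ π → IsLaplacianAutomorphism Γ π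
      adjacencyAutomorphism⇒laplacianAutomorphism automorphism =
        automorphism , preservesAdjacency⇒deg-preserved (to adjacencyAutomorphism⇔preservesAdjacency automorphism)

      laplacianAutomorphism⇔graphAutomorphism : IsLaplacianAutomorphism Γ π ⇔ IsGraphAutomorphism Γ π
      laplacianAutomorphism⇔graphAutomorphism = mk⇔
        (from graphAutomorphism⇔preservesAdjacency ∘ to adjacencyAutomorphism⇔preservesAdjacency ∘ proj₁)
        (adjacencyAutomorphism⇒laplacianAutomorphism ∘ from adjacencyAutomorphism⇔preservesAdjacency
           ∘ to graphAutomorphism⇔preservesAdjacency)

swap-not-laplacian : Σ ℕ (λ n → Σ (OrientedHypergraph n) (λ Γ → NoIsolatedVertex Γ
  × Σ (Permutation′ n) (λ π → IsAdjacencyAutomorphism Γ π × ¬ IsLaplacianAutomorphism Γ π)))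
swap-not-laplacian = 2 , Γ , no-isolated-vertex , transpose 0F 1F , adjacency-preserved , degrees-differ
  where
  loop edge : Hyperedge 2
  loop = ⁅ 0F ⁆ , ⊥
  edge = ⁅ 0F ⁆ , ⁅ 1F ⁆

  Γ : OrientedHypergraph 2
  Γ = record
    { edges    = loop ∷ edge ∷ []
    ; unique   = ((λ ()) ∷ []) ∷ [] ∷ []
    ; disjoint = (λ { 0F _ () ; 1F _ (there ()) }) ∷ (λ { 0F _ () ; 1F (there ()) _ }) ∷ []
    }

  no-isolated-vertex : NoIsolatedVertex Γ
  no-isolated-vertex 0F ()
  no-isolated-vertex 1F ()

  adjacency-preserved : IsAdjacencyAutomorphism Γ (transpose 0F 1F)
  adjacency-preserved 0F 0F = refl
  adjacency-preserved 0F 1F = refl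
  adjacency-preserved 1F 0F = refl
  adjacency-preserved 1F 1F = refl

  degrees-differ : ¬ IsLaplacianAutomorphism Γ (transpose 0F 1F)
  degrees-differ (_ , deg-preserved) with deg-preserved 0F
  ... | ()

proposition1 :
    ((n : ℕ) (Γ : OrientedHypergraph n) → NoIsolatedVertex Γ →
      ((p : Permutation′ n) → IsHypergraphAutomorphism Γ p → IsLaplacianAutomorphism Γ p)
      × ((p : Permutation′ n) → IsLaplacianAutomorphism Γ p → IsAdjacencyAutomorphism Γ p)
      × (IsSimpleGraph Γ →
          (p : Permutation′ n) →
            (IsAdjacencyAutomorphism Γ p ⇔ IsLaplacianAutomorphism Γ p)
            × (IsLaplacianAutomorphism Γ p ⇔ IsGraphAutomorphism Γ p)))
    × Σ ℕ (λ n → Σ (OrientedHypergraph n) (λ Γ → NoIsolatedVertex Γ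
        × Σ (Permutation′ n) (λ p →
            IsAdjacencyAutomorphism Γ p × ¬ IsLaplacianAutomorphism Γ p)))
proposition1 =
  (λ n Γ _ →
      hypergraphAutomorphism⇒laplacianAutomorphism Γ
    , (λ _ → proj₁)
    , λ simple π → mk⇔ (adjacencyAutomorphism⇒laplacianAutomorphism Γ simple π) proj₁
                 , laplacianAutomorphism⇔graphAutomorphism Γ simple π)
  , swap-not-laplacian
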